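{- Let $d \geq 1$ and let $V$ be a finite nonempty set. If $(V,\mathcal{H})$ and $(V,\mathcal{H}')$ both belong to $\mathrm{TBPav}(d)$, then $(V,\mathcal{H}\cup\mathcal{H}') \in \mathrm{TBPav}(d)$.
   Context: A (finite) simplicial complex is a pair $S=(V,\mathcal{H})$ where $V$ is a finite nonempty set and $\mathcal{H}\subseteq 2^V$ contains all singletons and is closed under taking subsets. Its rank is $\max\{|I| : I\in\mathcal{H}\}$ and its dimension is rank minus one. $P_n(V)$ (resp. $P_{\leq n}(V)$, $P_{\geq n}(V)$) denotes the set of subsets of $V$ with exactly (resp. at most, at least) $n$ elements. A flat of $S$ is a set $X\subseteq V$ such that $I\cup\{p\}\in\mathcal{H}$ for all $I\in\mathcal{H}\cap 2^X$ and $p\in V\setminus X$. Given a chain $F_0\subset F_1\subset\cdots\subset F_k$ of subsets of $V$, a set $X$ is a transversal of its successive differences if $X$ has an enumeration $x_1,\dots,x_k$ with $x_i\in F_i\setminus F_{i-1}$. $S$ is boolean representable (a BRSC) if there is a boolean matrix $M$ with columns indexed by $V$ such that $\mathcal{H}$ is exactly the set of $X\subseteq V$ for which some square submatrix with column set $X$ is nonsingular, i.e. congruent (by independently permuting rows and columns) to a lower unitriangular boolean matrix; equivalently, $\mathcal{H}$ is the set of transversals of successive differences of chains of flats of $S$. For $k\geq 1$ the $k$-truncation is $T_k(S)=(V,\mathcal{H}\cap P_{\leq k}(V))$. $S$ is a TBRSC (truncated boolean representable simplicial complex) if $S=T_k(S')$ for some BRSC $S'$ and some $k\geq1$. $S$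 is paving if $P_{\dim S}(V)\subseteq\mathcal{H}$. $\mathrm{TBPav}(d)$ denotes the class of paving TBRSCs of dimension $d$. -}

module Defs where

open import Data.Nat using (ℕ; suc; _+_; _≤_; _<_)
open import Data.Bool using (Bool; true; false)
open import Data.Fin using (Fin; toℕ)
open import Data.Fin.Subset using (Subset; _∈_; _⊆_; ∣_∣; ⁅_⁆)
open import Data.Product using (Σ; _×_; ∃; ∃-syntax)
open import Function.Bundles using (_⇔_)
open import Function.Definitions using (Injective)
open import Relation.Binary.PropositionalEquality using (_≡_)

-- Ground set V is modelled as Fin n; subsets of V are  Subset n.
-- A family of subsets (the 𝓗 of a complex) is a predicate on Subset n.
Family : ℕ → Set₁
Family n = Subset n → Set

IsSimplicialComplex : ∀ {n} → Family n → Set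
IsSimplicialComplex {n} 𝓗 =
  (∀ (p : Fin n) → 𝓗 ⁅ p ⁆) ×
  (∀ (X Y : Subset n) → Y ⊆ X → 𝓗 X → 𝓗 Y)

BoolMatrix : ℕ → ℕ → Set
BoolMatrix m n = Fin m → Fin n → Bool

-- Some square submatrix of M with column set X is nonsingular, i.e. after
-- enumerating its (distinct) rows r and columns c it is lower unitriangular:
-- diagonal entries 1 and entries above the diagonal 0.
HasNonsingularSubmatrix : ∀ {m n} → BoolMatrix m n → Subset n → Set
HasNonsingularSubmatrix {m} {n} M X =
  ∃[ k ] Σ (Fin k → Fin m) λ r → Σ (Fin k → Fin n) λ c →
    Injective _≡_ _≡_ r ×
    Injective _≡_ _≡_ c ×
    (∀ j → c j ∈ X) ×
    (∀ x → x ∈ X → ∃[ j ] c j ≡ x) ×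
    (∀ i → M (r i) (c i) ≡ true) ×
    (∀ i j → toℕ i < toℕ j → M (r i) (c j) ≡ false)

IsBRSC : ∀ {n} → Family n → Set
IsBRSC {n} 𝓗 =
  IsSimplicialComplex 𝓗 ×
  ∃[ m ] Σ (BoolMatrix m n) λ M → ∀ X → 𝓗 X ⇔ HasNonsingularSubmatrix M X

Truncation : ∀ {n} → ℕ → Family n → Family n
Truncation k 𝓗 X = 𝓗 X × ∣ X ∣ ≤ k

IsTBRSC : ∀ {n} → Family n → Set₁
IsTBRSC {n} 𝓗 =
  IsSimplicialComplex 𝓗 ×
  Σ (Family n) λ 𝓗' → ∃[ k ] (1 ≤ k × IsBRSC 𝓗' × (∀ X → 𝓗 X ⇔ Truncation k 𝓗' X))

HasDimension : ∀ {n} → ℕ → Family n → Set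
HasDimension {n} d 𝓗 =
  (∃[ I ] (𝓗 I × ∣ I ∣ ≡ suc d)) × (∀ I → 𝓗 I → ∣ I ∣ ≤ suc d)

IsPavingOfDim : ∀ {n} → ℕ → Family n → Set
IsPavingOfDim {n} d 𝓗 = ∀ (X : Subset n) → ∣ X ∣ ≡ d → 𝓗 X

TBPav : ∀ {n} → ℕ → Family n → Set₁
TBPav d 𝓗 = IsTBRSC 𝓗 × HasDimension d 𝓗 × IsPavingOfDim d 𝓗

-- A paving complex of dimension d contains every set of at most d points, so a
-- boolean representation M of its (d+1)-truncation makes every such set
-- nonsingular. Stack the representations M and M' of the two complexes into one
-- matrix N. A nonsingular submatrix of N on a set X with at most d+1 points has a
-- first (pivot) row r, column c; the row r comes from M, say. The set X - c is
-- small, so it is nonsingular already in M, and putting row r on top of that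
-- submatrix shows X nonsingular in M. Hence the (d+1)-truncation of the complex
-- represented by N is exactly the union.
module Submission where

open import Defs
open import Data.Nat using (ℕ; zero; suc; _+_; _≤_; _<_; _≤?_; z≤n; s≤s; s≤s⁻¹)
open import Data.Nat.Properties using (≤-trans; <⇒≤; ≰⇒>)
open import Data.Bool using (Bool; true; false)
open import Data.Fin using (Fin; zero; suc; toℕ; splitAt; _↑ˡ_; _↑ʳ_; _≟_)
open import Data.Fin.Properties using (↑ˡ-injective; ↑ʳ-injective; splitAt-↑ˡ; splitAt-↑ʳ)
import Data.Fin.Properties as Fin
open import Data.Fin.Subset using (Subset; _∈_; _∉_; _⊆_; ∣_∣; ⁅_⁆; _-_; inside; outside)
open import Data.Fin.Subset.Properties
  using (_∈?_; x∈p∧x≢y⇒x∈p-y; p─q⊆p; x∈p⇒∣p-x∣<∣p∣; ∣p∣≤n; out⊆; in⊆in)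
open import Data.Vec using ([]; _∷_; there)
import Data.Vec.Functional as Vector
open import Data.Sum using (_⊎_; inj₁; inj₂; [_,_]′)
open import Data.Product using (Σ; _×_; ∃-syntax; _,_; proj₁; proj₂)
open import Function.Base using (_∘_)
open import Function.Bundles using (_⇔_; mk⇔; Equivalence)
open import Function.Definitions using (Injective)
open import Relation.Binary.PropositionalEquality
  using (_≡_; _≢_; _≗_; refl; sym; trans; cong; subst)
open import Relation.Nullary using (yes; no; contradiction)

open Equivalence using (to; from)

private
  variable
    m m' n d k : ℕ

x∉p-x : (p : Subset n) (x : Fin n) → x ∉ p - x
x∉p-x (_ ∷ p) (suc x) (there x∈p-x) = x∉p-x p x x∈p-x

x∈p-y⇒x≢y : {p : Subset n} {x y : Fin n} → x ∈ p - y → x ≢ y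
x∈p-y⇒x≢y {p = p} {y = y} x∈p-y refl = x∉p-x p y x∈p-y

x∈p-y⇒x∈p : {p : Subset n} {x y : Fin n} → x ∈ p - y → x ∈ p
x∈p-y⇒x∈p {p = p} {y = y} = p─q⊆p p ⁅ y ⁆

p⊆q⇒p-x⊆q-x : {p q : Subset n} {x : Fin n} → p ⊆ q → p - x ⊆ q - x
p⊆q⇒p-x⊆q-x p⊆q y∈p-x = x∈p∧x≢y⇒x∈p-y (p⊆q (x∈p-y⇒x∈p y∈p-x)) (x∈p-y⇒x≢y y∈p-x)

p⊆q∧x∉p⇒p⊆q-x : {p q : Subset n} {x : Fin n} → p ⊆ q → x ∉ p → p ⊆ q - x
p⊆q∧x∉p⇒p⊆q-x p⊆q x∉p y∈p = x∈p∧x≢y⇒x∈p-y (p⊆q y∈p) λ { refl → x∉p y∈p }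

superset-of-size : (p : Subset n) {d : ℕ} → ∣ p ∣ ≤ d → d ≤ n → ∃[ q ] p ⊆ q × ∣ q ∣ ≡ d
superset-of-size [] z≤n z≤n = [] , (λ ()) , refl
superset-of-size (inside ∷ p) (s≤s ∣p∣≤d) (s≤s d≤n) =
  let q , p⊆q , ∣q∣≡d = superset-of-size p ∣p∣≤d d≤n in inside ∷ q , in⊆in p⊆q , cong suc ∣q∣≡d
superset-of-size (outside ∷ p) {d = zero} ∣p∣≤0 _ =
  let q , p⊆q , ∣q∣≡0 = superset-of-size p ∣p∣≤0 z≤n in outside ∷ q , out⊆ p⊆q , ∣q∣≡0
superset-of-size (outside ∷ p) {d = suc d} ∣p∣≤1+d (s≤s d≤n) with ∣ p ∣ ≤? d
... | yes ∣p∣≤d =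
  let q , p⊆q , ∣q∣≡d = superset-of-size p ∣p∣≤d d≤n in inside ∷ q , out⊆ p⊆q , cong suc ∣q∣≡d
... | no ∣p∣≰d =
  let q , p⊆q , ∣q∣≡1+d = superset-of-size p ∣p∣≤1+d (≤-trans (≰⇒> ∣p∣≰d) (∣p∣≤n p))
  in outside ∷ q , out⊆ p⊆q , ∣q∣≡1+d

record Unitriangular (M : BoolMatrix m n) (X : Subset n) (k : ℕ) : Set where
  field
    row            : Fin k → Fin m
    col            : Fin k → Fin n
    row-injective  : Injective _≡_ _≡_ row
    col-injective  : Injective _≡_ _≡_ col
    col∈X          : ∀ j → col j ∈ X
    col-onto       : ∀ {x} → x ∈ X → ∃[ j ] col j ≡ x
    diagonal       : ∀ i → M (row i) (col i) ≡ true
    above-diagonal : ∀ i j → toℕ i < toℕ j → M (row i) (col j) ≡ false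

Nonsingular : BoolMatrix m n → Subset n → Set
Nonsingular M X = ∃[ k ] Unitriangular M X k

nonsingular⇔ : {M : BoolMatrix m n} {X : Subset n} → Nonsingular M X ⇔ HasNonsingularSubmatrix M X
nonsingular⇔ = mk⇔
  (λ (k , U) → let open Unitriangular U in
    k , row , col , row-injective , col-injective , col∈X , (λ _ → col-onto) , diagonal , above-diagonal)
  (λ (k , r , c , r-inj , c-inj , c∈X , c-onto , diag , above) →
    k , record { row = r ; col = c ; row-injective = r-inj ; col-injective = c-inj ; col∈X = c∈X
               ; col-onto = c-onto _ ; diagonal = diag ; above-diagonal = above })

empty-unitriangular : {M : BoolMatrix m n} {M' : BoolMatrix m' n} {X Y : Subset n} →
  Y ⊆ X → Unitriangular M X 0 → Unitriangular M' Y 0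
empty-unitriangular Y⊆X U = record
  { row = λ () ; col = λ () ; row-injective = λ {} ; col-injective = λ {} ; col∈X = λ ()
  ; col-onto = λ y∈Y → contradiction (proj₁ (col-onto (Y⊆X y∈Y))) λ () ; diagonal = λ ()
  ; above-diagonal = λ () }
  where open Unitriangular U

Pivot : (Fin n → Bool) → Subset n → Fin n → Set
Pivot r X c = c ∈ X × r c ≡ true × (∀ {x} → x ∈ X - c → r x ≡ false)

Pivot-≗ : {r r' : Fin n → Bool} {X : Subset n} {c : Fin n} → r ≗ r' → Pivot r X c → Pivot r' X c
Pivot-≗ r≗r' (c∈X , rc≡true , off) =
  c∈X , trans (sym (r≗r' _)) rc≡true , λ x∈X-c → trans (sym (r≗r' _)) (off x∈X-c)

module _ {M : BoolMatrix m n} {X : Subset n} where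

  unitriangular-uncons : Unitriangular M X (suc k) →
    ∃[ r ] ∃[ c ] Pivot (M r) X c × Unitriangular M (X - c) k
  unitriangular-uncons U = row zero , col zero , pivot , record
    { row = Vector.tail row ; col = Vector.tail col
    ; row-injective = λ e → Fin.suc-injective (row-injective e)
    ; col-injective = λ e → Fin.suc-injective (col-injective e)
    ; col∈X = λ j → x∈p∧x≢y⇒x∈p-y (col∈X (suc j)) λ e → Fin.0≢1+n (sym (col-injective e))
    ; col-onto = onto-tail
    ; diagonal = λ i → diagonal (suc i)
    ; above-diagonal = λ i j i<j → above-diagonal (suc i) (suc j) (s≤s i<j) }
    where
    open Unitriangular U
    onto-tail : ∀ {x} → x ∈ X - col zero → ∃[ j ] col (suc j) ≡ x
    onto-tail x∈X-c with col-onto (x∈p-y⇒x∈p x∈X-c)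
    ... | zero , refl = contradiction refl (x∈p-y⇒x≢y x∈X-c)
    ... | suc j , e = j , e
    pivot : Pivot (M (row zero)) X (col zero)
    pivot = col∈X zero , diagonal zero , λ x∈X-c →
      let j , e = onto-tail x∈X-c in subst (λ x → M (row zero) x ≡ false) e (above-diagonal zero (suc j) (s≤s z≤n))

  unitriangular-cons : ∀ {r c} → Pivot (M r) X c → Unitriangular M (X - c) k → Unitriangular M X (suc k)
  unitriangular-cons {k} {r} {c} (c∈X , Mrc≡true , off) U = record
    { row = r Vector.∷ row ; col = c Vector.∷ col
    ; row-injective = row-injective′ ; col-injective = col-injective′
    ; col∈X = λ { zero → c∈X ; (suc j) → x∈p-y⇒x∈p (col∈X j) }
    ; col-onto = col-onto′
    ; diagonal = λ { zero → Mrc≡true ; (suc i) → diagonal i }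
    ; above-diagonal = λ { zero (suc j) _ → off (col∈X j) ; (suc i) (suc j) (s≤s i<j) → above-diagonal i j i<j } }
    where
    open Unitriangular U
    r≢row : ∀ j → r ≢ row j
    r≢row j refl = contradiction (trans (sym (diagonal j)) (off (col∈X j))) λ ()
    c≢col : ∀ j → c ≢ col j
    c≢col j e = x∉p-x X c (subst (_∈ X - c) (sym e) (col∈X j))
    row-injective′ : Injective _≡_ _≡_ (r Vector.∷ row)
    row-injective′ {zero} {zero} _ = refl
    row-injective′ {zero} {suc j} e = contradiction e (r≢row j)
    row-injective′ {suc i} {zero} e = contradiction (sym e) (r≢row i)
    row-injective′ {suc i} {suc j} e = cong suc (row-injective e)
    col-injective′ : Injective _≡_ _≡_ (c Vector.∷ col)
    col-injective′ {zero} {zero} _ = refl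
    col-injective′ {zero} {suc j} e = contradiction e (c≢col j)
    col-injective′ {suc i} {zero} e = contradiction (sym e) (c≢col i)
    col-injective′ {suc i} {suc j} e = cong suc (col-injective e)
    col-onto′ : ∀ {x} → x ∈ X → ∃[ j ] (c Vector.∷ col) j ≡ x
    col-onto′ {x} x∈X with x ≟ c
    ... | yes refl = zero , refl
    ... | no x≢c = let j , e = col-onto (x∈p∧x≢y⇒x∈p-y x∈X x≢c) in suc j , e

nonsingular-cons : {M : BoolMatrix m n} {X : Subset n} {r : Fin m} {c : Fin n} →
  Pivot (M r) X c → Nonsingular M (X - c) → Nonsingular M X
nonsingular-cons pivot (k , U) = suc k , unitriangular-cons pivot U

unitriangular-⊆ : {M : BoolMatrix m n} {X Y : Subset n} → Y ⊆ X → Unitriangular M X k → Nonsingular M Y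
unitriangular-⊆ {k = zero} Y⊆X U = 0 , empty-unitriangular Y⊆X U
unitriangular-⊆ {k = suc k} {Y = Y} Y⊆X U with unitriangular-uncons U
... | r , c , (c∈X , Mrc≡true , off) , V with c ∈? Y
... | no c∉Y = unitriangular-⊆ (p⊆q∧x∉p⇒p⊆q-x Y⊆X c∉Y) V
... | yes c∈Y = nonsingular-cons (c∈Y , Mrc≡true , off ∘ Y-c⊆X-c) (unitriangular-⊆ Y-c⊆X-c V)
  where
  Y-c⊆X-c : Y - c ⊆ _ - c
  Y-c⊆X-c = p⊆q⇒p-x⊆q-x Y⊆X

nonsingular-⊆ : {M : BoolMatrix m n} {X Y : Subset n} → Y ⊆ X → Nonsingular M X → Nonsingular M Y
nonsingular-⊆ Y⊆X (_ , U) = unitriangular-⊆ Y⊆X U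

nonsingular-rows : {M : BoolMatrix m n} {N : BoolMatrix m' n} {X : Subset n} (f : Fin m → Fin m') →
  Injective _≡_ _≡_ f → (∀ i → N (f i) ≗ M i) → Nonsingular M X → Nonsingular N X
nonsingular-rows f f-injective N∘f≗M (k , U) = k , record
  { row = λ i → f (row i) ; col = col
  ; row-injective = λ e → row-injective (f-injective e) ; col-injective = col-injective
  ; col∈X = col∈X ; col-onto = col-onto
  ; diagonal = λ i → trans (N∘f≗M (row i) (col i)) (diagonal i)
  ; above-diagonal = λ i j i<j → trans (N∘f≗M (row i) (col j)) (above-diagonal i j i<j) }
  where open Unitriangular U

stack : BoolMatrix m n → BoolMatrix m' n → BoolMatrix (m + m') n
stack {m} M M' i = [ M , M' ]′ (splitAt m i)

module _ (M : BoolMatrix m n) (M' : BoolMatrix m' n) where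

  stack-↑ˡ : ∀ i → stack M M' (i ↑ˡ m') ≗ M i
  stack-↑ˡ i _ rewrite splitAt-↑ˡ m i m' = refl

  stack-↑ʳ : ∀ i → stack M M' (m ↑ʳ i) ≗ M' i
  stack-↑ʳ i _ rewrite splitAt-↑ʳ m m' i = refl

  stack-row : ∀ r → (∃[ a ] stack M M' r ≗ M a) ⊎ (∃[ b ] stack M M' r ≗ M' b)
  stack-row r with splitAt m r
  ... | inj₁ a = inj₁ (a , λ _ → refl)
  ... | inj₂ b = inj₂ (b , λ _ → refl)

  nonsingular-stackˡ : {X : Subset n} → Nonsingular M X → Nonsingular (stack M M') X
  nonsingular-stackˡ = nonsingular-rows (_↑ˡ m') (↑ˡ-injective m' _ _) stack-↑ˡ

  nonsingular-stackʳ : {X : Subset n} → Nonsingular M' X → Nonsingular (stack M M') X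
  nonsingular-stackʳ = nonsingular-rows (m ↑ʳ_) (↑ʳ-injective m _ _) stack-↑ʳ

∣p-x∣≤d : {p : Subset n} {x : Fin n} → x ∈ p → ∣ p ∣ ≤ suc d → ∣ p - x ∣ ≤ d
∣p-x∣≤d x∈p ∣p∣≤1+d = s≤s⁻¹ (≤-trans (x∈p⇒∣p-x∣<∣p∣ x∈p) ∣p∣≤1+d)

nonsingular-stack⁻ : {M : BoolMatrix m n} {M' : BoolMatrix m' n} {X : Subset n} →
  (∀ Y → ∣ Y ∣ ≤ d → Nonsingular M Y) → (∀ Y → ∣ Y ∣ ≤ d → Nonsingular M' Y) →
  Nonsingular (stack M M') X → ∣ X ∣ ≤ suc d → Nonsingular M X ⊎ Nonsingular M' X
nonsingular-stack⁻ _ _ (zero , U) _ = inj₁ (0 , empty-unitriangular (λ x∈X → x∈X) U)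
nonsingular-stack⁻ {M = M} {M'} {X} small small' (suc k , U) ∣X∣≤1+d
  with unitriangular-uncons U
... | r , c , pivot , _ with stack-row M M' r
... | inj₁ (a , r≗a) = inj₁ (nonsingular-cons (Pivot-≗ r≗a pivot) (small (X - c) (∣p-x∣≤d (proj₁ pivot) ∣X∣≤1+d)))
... | inj₂ (b , r≗b) = inj₂ (nonsingular-cons (Pivot-≗ r≗b pivot) (small' (X - c) (∣p-x∣≤d (proj₁ pivot) ∣X∣≤1+d)))

module _ {H : Family n} where

  nonsingular-isBRSC : {N : BoolMatrix m n} → (∀ p → Nonsingular N ⁅ p ⁆) → IsBRSC (Nonsingular N)
  nonsingular-isBRSC {m} {N} singletons =
    (singletons , λ X Y Y⊆X → nonsingular-⊆ Y⊆X) , m , N , λ X → nonsingular⇔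

  truncation⇒IsTBRSC : {N : BoolMatrix m n} → IsSimplicialComplex H → 1 ≤ k →
    (∀ X → H X ⇔ (Nonsingular N X × ∣ X ∣ ≤ k)) → IsTBRSC H
  truncation⇒IsTBRSC {k = k} {N} complex@(singletons , _) 1≤k H⇔ =
    complex , Nonsingular N , k , 1≤k ,
    nonsingular-isBRSC (λ p → proj₁ (to (H⇔ ⁅ p ⁆) (singletons p))) , H⇔

  IsTBRSC⇒truncation : IsTBRSC H → HasDimension d H →
    ∃[ m ] Σ (BoolMatrix m n) λ M → ∀ X → H X ⇔ (Nonsingular M X × ∣ X ∣ ≤ suc d)
  IsTBRSC⇒truncation {d} (_ , H' , k , _ , (_ , m , M , H'⇔) , H⇔) ((I , H-I , ∣I∣≡1+d) , bound) =
    m , M , λ X → mk⇔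
      (λ H-X → from nonsingular⇔ (to (H'⇔ X) (proj₁ (to (H⇔ X) H-X))) , bound X H-X)
      (λ (ns , ∣X∣≤1+d) → from (H⇔ X) (from (H'⇔ X) (to nonsingular⇔ ns) , ≤-trans ∣X∣≤1+d 1+d≤k))
    where
    1+d≤k : suc d ≤ k
    1+d≤k = subst (_≤ k) ∣I∣≡1+d (proj₂ (to (H⇔ I) H-I))

  TBPav⇒small-faces : TBPav d H → ∀ X → ∣ X ∣ ≤ d → H X
  TBPav⇒small-faces {d} ((complex , _) , ((I , _ , ∣I∣≡1+d) , _) , paving) X ∣X∣≤d =
    let Y , X⊆Y , ∣Y∣≡d = superset-of-size X ∣X∣≤d d≤n in proj₂ complex Y X X⊆Y (paving Y ∣Y∣≡d)
    where
    d≤n : d ≤ n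
    d≤n = <⇒≤ (subst (_≤ n) ∣I∣≡1+d (∣p∣≤n I))

module _ {H H' : Family n} where

  IsSimplicialComplex-∪ : IsSimplicialComplex H → IsSimplicialComplex H' →
    IsSimplicialComplex (λ X → H X ⊎ H' X)
  IsSimplicialComplex-∪ (singletons , closed) (_ , closed') =
    (λ p → inj₁ (singletons p)) ,
    λ { X Y Y⊆X (inj₁ H-X) → inj₁ (closed X Y Y⊆X H-X) ; X Y Y⊆X (inj₂ H'-X) → inj₂ (closed' X Y Y⊆X H'-X) }

  HasDimension-∪ : HasDimension d H → HasDimension d H' → HasDimension d (λ X → H X ⊎ H' X)
  HasDimension-∪ ((I , H-I , ∣I∣≡1+d) , bound) (_ , bound') =
    (I , inj₁ H-I , ∣I∣≡1+d) , λ { X (inj₁ H-X) → bound X H-X ; X (inj₂ H'-X) → bound' X H'-X }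

  stack-truncation-∪ : {M : BoolMatrix m n} {M' : BoolMatrix m' n} →
    (∀ X → H X ⇔ (Nonsingular M X × ∣ X ∣ ≤ suc d)) → (∀ X → H' X ⇔ (Nonsingular M' X × ∣ X ∣ ≤ suc d)) →
    (∀ X → ∣ X ∣ ≤ d → H X) → (∀ X → ∣ X ∣ ≤ d → H' X) →
    ∀ X → (H X ⊎ H' X) ⇔ (Nonsingular (stack M M') X × ∣ X ∣ ≤ suc d)
  stack-truncation-∪ {M = M} {M'} H⇔ H'⇔ small small' X = mk⇔
    (λ { (inj₁ H-X) → let ns , ∣X∣≤1+d = to (H⇔ X) H-X in nonsingular-stackˡ M M' ns , ∣X∣≤1+d
       ; (inj₂ H'-X) → let ns , ∣X∣≤1+d = to (H'⇔ X) H'-X in nonsingular-stackʳ M M' ns , ∣X∣≤1+d })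
    (λ (ns , ∣X∣≤1+d) →
      [ (λ ns₁ → inj₁ (from (H⇔ X) (ns₁ , ∣X∣≤1+d))) , (λ ns₂ → inj₂ (from (H'⇔ X) (ns₂ , ∣X∣≤1+d))) ]′
      (nonsingular-stack⁻ (λ Y ∣Y∣≤d → proj₁ (to (H⇔ Y) (small Y ∣Y∣≤d)))
                          (λ Y ∣Y∣≤d → proj₁ (to (H'⇔ Y) (small' Y ∣Y∣≤d))) ns ∣X∣≤1+d))

-- The argument does not need the hypothesis d ≥ 1.
theorem5p3 : (d : ℕ) → 1 ≤ d → (n : ℕ) → (𝓗 𝓗' : Family (suc n)) →
    TBPav d 𝓗 → TBPav d 𝓗' → TBPav d (λ X → 𝓗 X ⊎ 𝓗' X)
theorem5p3 d _ n H H' P@(tbrsc , dim , paving) P'@(tbrsc' , dim' , _)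
  with IsTBRSC⇒truncation tbrsc dim | IsTBRSC⇒truncation tbrsc' dim'
... | _ , M , H⇔ | _ , M' , H'⇔ =
  truncation⇒IsTBRSC (IsSimplicialComplex-∪ (proj₁ tbrsc) (proj₁ tbrsc')) (s≤s z≤n)
    (stack-truncation-∪ H⇔ H'⇔ (TBPav⇒small-faces P) (TBPav⇒small-faces P')) ,
  HasDimension-∪ dim dim' ,
  λ X ∣X∣≡d → inj₁ (paving X ∣X∣≡d)
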